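{- For every nonnegative integer $n$, let $p(n)$ denote the number of (ordinary) partitions of $n$, and let $p_{ -1}(n)$ denote the number of signed partitions of $n$ in which the positive parts alternate in parity with the smallest positive part even (i.e., when the positive parts are listed in nondecreasing order, any two consecutive ones have opposite parity, and the smallest one is even), and the negative parts are distinct and each at most the number of positive parts. Then $p(n)=p_{ -1}(n)$ for all $n\ge 0$.
   Context: A partition of an integer $n$ is a finite nonincreasing sequence of positive integers (its parts) summing to $n$. A signed partition of an integer $n$ is a pair $(\pi,\nu)$ of ordinary partitions with $|\pi|-|\nu|=n$, where $|\cdot|$ denotes the sum of parts; the parts of $\pi$ are the positive parts and the parts of $\nu$ are the negative parts (their sizes). The empty signed partition is a signed partition of $0$. -}

module Defs where

open import Data.Nat using (ℕ; zero; suc; _+_; _≤_; _≥_; _<_; _>_)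
open import Data.List using (List; []; _∷_; length; reverse)
open import Data.Nat.ListAction using (sum)
open import Data.List.Relation.Unary.All using (All)
open import Data.List.Relation.Unary.Linked using (Linked)
open import Data.Product using (Σ; _×_)
open import Data.Fin using (Fin)
open import Data.Unit using (⊤)
open import Data.Product using (_,_)
open import Data.Nat using (_%_)
open import Relation.Binary.PropositionalEquality using (_≡_)
open import Function.Bundles using (_↔_)

IsPartition : List ℕ → Set
IsPartition xs = Linked _≥_ xs × All (λ x → 1 ≤ x) xs

Partition : ℕ → Set
Partition n = Σ (List ℕ) λ xs → IsPartition xs × sum xs ≡ n

SignedPartition : ℕ → Set
SignedPartition n =
  Σ (List ℕ × List ℕ) λ { (π , ν) →
    IsPartition π × IsPartition ν × sum π ≡ n + sum ν }

Even : ℕ → Set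
Even x = x % 2 ≡ 0

-- a and b have opposite parity (stated as a proof-irrelevant equation on ℕ)
OppParity : ℕ → ℕ → Set
OppParity a b = (a + b) % 2 ≡ 1

AltFromEven : List ℕ → Set
AltFromEven []       = ⊤
AltFromEven (x ∷ xs) = Even x × Linked OppParity (x ∷ xs)

-- p_{-1}(n) objects: signed partitions (π , ν) of n such that the positive
-- parts π, listed in nondecreasing order (reverse π), alternate in parity
-- starting from an even smallest part, and the negative parts ν are
-- distinct (ν is nonincreasing, so distinct = strictly decreasing)
-- and each at most the number of positive parts.
RestrictedSignedPartition : ℕ → Set
RestrictedSignedPartition n =
  Σ (List ℕ × List ℕ) λ { (π , ν) →
    (IsPartition π × IsPartition ν × sum π ≡ n + sum ν)
    × AltFromEven (reverse π)
    × Linked _>_ ν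
    × All (λ y → y ≤ length π) ν }

HasCard : Set → ℕ → Set
HasCard A m = A ↔ Fin m

-- The bijection: let λ = (x₁ ≥ … ≥ x_k ≥ 1) and put x_{k+1} = 1.  Let ν be the set of indices i
-- for which the gap x_i − x_{i+1} is even, and π_i = x_i + #{j ∈ ν : j ≥ i}.  Then the gaps
-- π_i − π_{i+1} (with π_{k+1} = 1) are x_i − x_{i+1} + [i ∈ ν], all odd; so π alternates in
-- parity down to an even smallest part, ν has distinct parts ≤ k, and |π| = |λ| + Σ_{j ∈ ν} j.
-- Conversely an odd gap of π absorbs the bit [i ∈ ν], which recovers λ.  Processing λ from
-- its smallest part, each step raises all parts of ν by one and possibly adds a part 1.
-- Finiteness of p(n) comes from p_b(n) = p_{b−1}(n) + p_b(n − b), p_b counting parts ≤ b.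
module Submission where

open import Defs
open import Level using (Level)
open import Data.Nat using (ℕ; zero; suc; _+_; _∸_; _≤_; _<_; _>_; _≥_; z≤n; s≤s; _%_; _≟_; _≤?_; parity)
open import Data.Nat.Properties
  using ( +-comm; +-assoc; +-suc; +-identityʳ; +-cancelˡ-≡; +-cancelʳ-≡; +-commutativeSemigroup
        ; ≤-refl; ≤-trans; ≤-pred; <⇒≤; ≰⇒>; ≤∧≢⇒<; 1+n≰n; m≤m+n; m≤n+m; m≤n⇒m≤1+n; m≤n⇒∃[o]m+o≡n
        ; m+n∸n≡m; m+n∸m≡n; m+[n∸m]≡n; ≤-irrelevant; ≡-irrelevant )
open import Algebra.Properties.CommutativeSemigroup +-commutativeSemigroup using (interchange)
open import Data.Nat.DivMod using ([m+n]%n≡m%n)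
open import Data.Nat.Induction using (<-rec)
open import Data.Nat.ListAction using (sum)
open import Data.Parity.Base using (Parity; 0ℙ; 1ℙ; _⁻¹) renaming (_+_ to _⊕_)
open import Data.Parity.Properties using (+-homo-+; suc-homo-⁻¹; p+p≡0ℙ; p+p⁻¹≡1ℙ; ⁻¹-selfInverse)
  renaming (+-identityʳ to ⊕-identityʳ)
open import Data.List using (List; []; _∷_; _∷ʳ_; [_]; length; replicate; reverse; _ʳ++_)
open import Data.List.Properties using (reverse-++; reverse-involutive)
open import Data.List.Relation.Unary.All as All using (All; []; _∷_)
open import Data.List.Relation.Unary.Linked as Linked using (Linked; []; [-]; _∷_)
open import Data.Product using (Σ; ∃; _×_; _,_; proj₁; proj₂; uncurry)
open import Data.Sum using (_⊎_; inj₁; inj₂)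
open import Data.Sum.Function.Propositional using (_⊎-↔_)
open import Data.Unit using (tt)
open import Data.Empty using (⊥; ⊥-elim)
open import Data.Fin as Fin using (Fin)
open import Data.Fin.Properties using (+↔⊎)
open import Function.Base using (flip)
open import Function.Bundles using (_⇔_; mk⇔; Equivalence; _↔_; mk↔ₛ′)
open import Function.Properties.Inverse using (↔-sym; ↔-trans)
open import Relation.Binary.Core using (Rel)
open import Relation.Binary.Definitions using (Transitive; Symmetric)
open import Relation.Binary.PropositionalEquality
  using (_≡_; refl; sym; trans; cong; cong₂; subst; module ≡-Reasoning)
open import Relation.Nullary using (Irrelevant; yes; no)

open Equivalence using (to; from)

private variable
  a ℓ : Level
  A : Set a

headOr : A → List A → A
headOr s []      = s
headOr _ (x ∷ _) = x

module _ {R : Rel A ℓ} where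

  Linked-∷-∷ʳ⁺ : ∀ {x xs s} → R x (headOr s xs) → Linked R (xs ∷ʳ s) → Linked R (x ∷ xs ∷ʳ s)
  Linked-∷-∷ʳ⁺ {xs = []}    r _ = r ∷ [-]
  Linked-∷-∷ʳ⁺ {xs = _ ∷ _} r l = r ∷ l

  Linked-∷-∷ʳ⁻ : ∀ {x xs s} → Linked R (x ∷ xs ∷ʳ s) → R x (headOr s xs) × Linked R (xs ∷ʳ s)
  Linked-∷-∷ʳ⁻ {xs = []}    (r ∷ l) = r , l
  Linked-∷-∷ʳ⁻ {xs = _ ∷ _} (r ∷ l) = r , l

  Linked-∷ʳ⇔ : Transitive R → ∀ {xs s} → Linked R (xs ∷ʳ s) ⇔ (Linked R xs × All (λ x → R x s) xs)
  Linked-∷ʳ⇔ R-trans = mk⇔ split (uncurry join)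
    where
    split : ∀ {xs s} → Linked R (xs ∷ʳ s) → Linked R xs × All (λ x → R x s) xs
    split {[]}                  _       = [] , []
    split {_ ∷ []}              (r ∷ _) = [-] , r ∷ []
    split {_ ∷ y ∷ ys} {s} (r ∷ l) with split {y ∷ ys} {s} l
    ... | l′ , rs@(r′ ∷ _) = r ∷ l′ , R-trans r r′ ∷ rs
    join : ∀ {xs s} → Linked R xs → All (λ x → R x s) xs → Linked R (xs ∷ʳ s)
    join []      []       = [-]
    join [-]     (r ∷ []) = r ∷ [-]
    join (r ∷ l) (_ ∷ rs) = r ∷ join l rs

  Linked-reverse⁺ : Symmetric R → ∀ {xs} → Linked R xs → Linked R (reverse xs)
  Linked-reverse⁺ R-sym {[]}    _ = []
  Linked-reverse⁺ R-sym {_ ∷ _} l = ʳ++⁺ l [-]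
    where
    ʳ++⁺ : ∀ {x xs acc} → Linked R (x ∷ xs) → Linked R (x ∷ acc) → Linked R (xs ʳ++ x ∷ acc)
    ʳ++⁺ [-]     la = la
    ʳ++⁺ (r ∷ l) la = ʳ++⁺ l (R-sym r ∷ la)

  Linked-reverse⁻ : Symmetric R → ∀ {xs} → Linked R (reverse xs) → Linked R xs
  Linked-reverse⁻ R-sym {xs} l = subst (Linked R) (reverse-involutive xs) (Linked-reverse⁺ R-sym l)

×-irrelevant : ∀ {A B : Set} → Irrelevant A → Irrelevant B → Irrelevant (A × B)
×-irrelevant irrA irrB (a , b) (a′ , b′) = cong₂ _,_ (irrA a a′) (irrB b b′)

proj₁-injective : ∀ {A : Set} {P : A → Set} → (∀ {a} → Irrelevant (P a)) →
                  ∀ {p q : Σ A P} → proj₁ p ≡ proj₁ q → p ≡ q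
proj₁-injective irr {a , _} {.a , _} refl = cong (a ,_) (irr _ _)

toℕ : Parity → ℕ
toℕ 0ℙ = 0
toℕ 1ℙ = 1

toℕ-injective : ∀ {p q} → toℕ p ≡ toℕ q → p ≡ q
toℕ-injective {0ℙ} {0ℙ} _ = refl
toℕ-injective {1ℙ} {1ℙ} _ = refl

parity-toℕ : ∀ p → parity (toℕ p) ≡ p
parity-toℕ 0ℙ = refl
parity-toℕ 1ℙ = refl

n%2≡toℕ[parity[n]] : ∀ n → n % 2 ≡ toℕ (parity n)
n%2≡toℕ[parity[n]] 0             = refl
n%2≡toℕ[parity[n]] 1             = refl
n%2≡toℕ[parity[n]] (suc (suc n)) = begin
  (2 + n) % 2    ≡⟨ cong (_% 2) (+-comm 2 n) ⟩
  (n + 2) % 2    ≡⟨ [m+n]%n≡m%n n 2 ⟩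
  n % 2          ≡⟨ n%2≡toℕ[parity[n]] n ⟩
  toℕ (parity n) ∎
  where open ≡-Reasoning

%2≡toℕ⇔parity≡ : ∀ n p → n % 2 ≡ toℕ p ⇔ parity n ≡ p
%2≡toℕ⇔parity≡ n p = mk⇔
  (λ eq → toℕ-injective (trans (sym (n%2≡toℕ[parity[n]] n)) eq))
  (λ eq → trans (n%2≡toℕ[parity[n]] n) (cong toℕ eq))

parity[b+d+b]≡parity[d] : ∀ b d → parity (b + d + b) ≡ parity d
parity[b+d+b]≡parity[d] b d = begin
  parity (b + d + b)        ≡⟨ cong parity (trans (cong (_+ b) (+-comm b d)) (+-assoc d b b)) ⟩
  parity (d + (b + b))      ≡⟨ +-homo-+ d (b + b) ⟩
  parity d ⊕ parity (b + b) ≡⟨ cong (parity d ⊕_) (trans (+-homo-+ b b) (p+p≡0ℙ (parity b))) ⟩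
  parity d ⊕ 0ℙ             ≡⟨ ⊕-identityʳ (parity d) ⟩
  parity d                  ∎
  where open ≡-Reasoning

OppParity[b+d,b]⇔odd : ∀ b d → OppParity (b + d) b ⇔ parity d ≡ 1ℙ
OppParity[b+d,b]⇔odd b d = mk⇔
  (λ opp → trans (sym (parity[b+d+b]≡parity[d] b d)) (to (%2≡toℕ⇔parity≡ (b + d + b) 1ℙ) opp))
  (λ odd → from (%2≡toℕ⇔parity≡ (b + d + b) 1ℙ) (trans (parity[b+d+b]≡parity[d] b d) odd))

OppParity-sym : Symmetric OppParity
OppParity-sym {a} {b} = subst (λ z → z % 2 ≡ 1) (+-comm a b)

Even⇔OppParity[1] : ∀ z → Even z ⇔ OppParity 1 z
Even⇔OppParity[1] z = mk⇔
  (λ even → from (%2≡toℕ⇔parity≡ (1 + z) 1ℙ)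
              (trans (+-homo-+ 1 z) (cong _⁻¹ (to (%2≡toℕ⇔parity≡ z 0ℙ) even))))
  (λ opp → from (%2≡toℕ⇔parity≡ z 0ℙ)
              (sym (⁻¹-selfInverse (trans (sym (+-homo-+ 1 z)) (to (%2≡toℕ⇔parity≡ (1 + z) 1ℙ) opp)))))

parity[n+toℕ[parity[n]⁻¹]]≡1ℙ : ∀ n → parity (n + toℕ (parity n ⁻¹)) ≡ 1ℙ
parity[n+toℕ[parity[n]⁻¹]]≡1ℙ n = begin
  parity (n + toℕ (parity n ⁻¹))        ≡⟨ +-homo-+ n _ ⟩
  parity n ⊕ parity (toℕ (parity n ⁻¹)) ≡⟨ cong (parity n ⊕_) (parity-toℕ _) ⟩
  parity n ⊕ parity n ⁻¹                ≡⟨ p+p⁻¹≡1ℙ (parity n) ⟩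
  1ℙ                                    ∎
  where open ≡-Reasoning

odd-split : ∀ {d} → parity d ≡ 1ℙ → ∀ c → ∃ λ e → d ≡ e + toℕ c × parity e ⁻¹ ≡ c
odd-split {d}     odd 0ℙ = d , sym (+-identityʳ d) , cong _⁻¹ odd
odd-split {suc e} odd 1ℙ = e , +-comm 1 e , cong _⁻¹ (trans (sym (suc-homo-⁻¹ e)) (cong _⁻¹ odd))

OddDrop : ℕ → ℕ → Set
OddDrop a b = a ≥ b × OppParity a b

oddDrop : ∀ b {d} → parity d ≡ 1ℙ → OddDrop (b + d) b
oddDrop b {d} odd = m≤m+n b d , from (OppParity[b+d,b]⇔odd b d) odd

oddDrop⇒odd-gap : ∀ {a b} → OddDrop a b → ∃ λ d → a ≡ b + d × parity d ≡ 1ℙ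
oddDrop⇒odd-gap {a} {b} (b≤a , opp) = a ∸ b , sym b+d≡a ,
  to (OppParity[b+d,b]⇔odd b (a ∸ b)) (subst (λ z → OppParity z b) (sym b+d≡a) opp)
  where
  b+d≡a : b + (a ∸ b) ≡ a
  b+d≡a = m+[n∸m]≡n b≤a

oddDrop-raise : ∀ {x y} L → x ≥ y → OddDrop (x + (L + toℕ (parity (x ∸ y) ⁻¹))) (y + L)
oddDrop-raise {x} {y} L y≤x =
  subst (λ z → OddDrop z (y + L)) shuffle (oddDrop (y + L) (parity[n+toℕ[parity[n]⁻¹]]≡1ℙ (x ∸ y)))
  where
  c = toℕ (parity (x ∸ y) ⁻¹)
  shuffle : y + L + (x ∸ y + c) ≡ x + (L + c)
  shuffle = trans (interchange y L (x ∸ y) c) (cong (_+ (L + c)) (m+[n∸m]≡n y≤x))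

oddDrop-lower : ∀ {y} x′ L c → OddDrop y (x′ + L) →
                let x = y ∸ (L + toℕ c) in x ≥ x′ × parity (x ∸ x′) ⁻¹ ≡ c × x + (L + toℕ c) ≡ y
oddDrop-lower x′ L c drop with oddDrop⇒odd-gap drop
... | d , refl , odd with odd-split {d} odd c
... | e , refl , parity[e]⁻¹≡c
  rewrite interchange x′ L e (toℕ c) | m+n∸n≡m (x′ + e) (L + toℕ c) | m+n∸m≡n x′ e =
  m≤m+n x′ e , parity[e]⁻¹≡c , refl

raise : Parity → List ℕ → List ℕ
raise c []      = replicate (toℕ c) 1
raise c (v ∷ ν) = suc v ∷ raise c ν

lower : List ℕ → List ℕ
lower []                = []
lower (zero ∷ ν)        = lower ν
lower (suc zero ∷ ν)    = lower ν
lower (suc (suc v) ∷ ν) = suc v ∷ lower ν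

hasOne : List ℕ → Parity
hasOne []                = 0ℙ
hasOne (zero ∷ ν)        = hasOne ν
hasOne (suc zero ∷ _)    = 1ℙ
hasOne (suc (suc _) ∷ ν) = hasOne ν

record DistinctParts (k : ℕ) (ν : List ℕ) : Set where
  constructor distinctParts
  field
    decreasing : Linked _>_ ν
    positive   : All (1 ≤_) ν
    bounded    : All (_≤ k) ν

length-raise : ∀ c ν → length (raise c ν) ≡ length ν + toℕ c
length-raise 0ℙ []      = refl
length-raise 1ℙ []      = refl
length-raise c  (v ∷ ν) = cong suc (length-raise c ν)

sum-raise : ∀ c ν → sum (raise c ν) ≡ sum ν + length (raise c ν)
sum-raise 0ℙ []      = refl
sum-raise 1ℙ []      = refl
sum-raise c  (v ∷ ν) = begin
  suc v + sum (raise c ν)              ≡⟨ cong (suc v +_) (sum-raise c ν) ⟩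
  suc v + (sum ν + length (raise c ν)) ≡⟨ cong suc (+-assoc v (sum ν) _) ⟨
  suc (v + sum ν + length (raise c ν)) ≡⟨ +-suc (v + sum ν) _ ⟨
  v + sum ν + suc (length (raise c ν)) ∎
  where open ≡-Reasoning

raise⁺ : ∀ {k} c {ν} → DistinctParts k ν → DistinctParts (suc k) (raise c ν)
raise⁺ c {ν} (distinctParts dec pos bnd) = distinctParts (decreasing c dec pos) (positive c ν) (bounded c bnd)
  where
  decreasing : ∀ c {ν} → Linked _>_ ν → All (1 ≤_) ν → Linked _>_ (raise c ν)
  decreasing 0ℙ []         _          = []
  decreasing 1ℙ []         _          = [-]
  decreasing 0ℙ [-]        _          = [-]
  decreasing 1ℙ [-]        (1≤v ∷ []) = s≤s 1≤v ∷ [-]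
  decreasing c  (v>w ∷ ds) (_ ∷ ps)   = s≤s v>w ∷ decreasing c ds ps
  positive : ∀ c ν → All (1 ≤_) (raise c ν)
  positive 0ℙ []      = []
  positive 1ℙ []      = s≤s z≤n ∷ []
  positive c  (v ∷ ν) = s≤s z≤n ∷ positive c ν
  bounded : ∀ {k} c {ν} → All (_≤ k) ν → All (_≤ suc k) (raise c ν)
  bounded 0ℙ []         = []
  bounded 1ℙ []         = s≤s z≤n ∷ []
  bounded c  (v≤k ∷ bs) = s≤s v≤k ∷ bounded c bs

lower-raise : ∀ c {ν} → All (1 ≤_) ν → lower (raise c ν) ≡ ν
lower-raise 0ℙ []                   = refl
lower-raise 1ℙ []                   = refl
lower-raise c  (s≤s {n = v} _ ∷ ps) = cong (suc v ∷_) (lower-raise c ps)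

raise-lower : ∀ {ν} → Linked _>_ ν → All (1 ≤_) ν → raise (hasOne ν) (lower ν) ≡ ν
raise-lower {[]}                  _            _              = refl
raise-lower {zero ∷ _}            _            (() ∷ _)
raise-lower {suc zero ∷ []}       _            _              = refl
raise-lower {suc zero ∷ _ ∷ _}    (s≤s () ∷ _) (_ ∷ s≤s _ ∷ _)
raise-lower {suc (suc v) ∷ []}    _            _              = refl
raise-lower {suc (suc v) ∷ _ ∷ _} (_ ∷ ds)     (_ ∷ ps)       = cong (suc (suc v) ∷_) (raise-lower ds ps)

lower⁺ : ∀ {k ν} → DistinctParts (suc k) ν → DistinctParts k (lower ν)
lower⁺ {ν = ν} (distinctParts dec pos bnd) =
  distinctParts (decreasing (hasOne ν) (subst (Linked _>_) (sym (raise-lower dec pos)) dec))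
                (positive ν) (bounded bnd)
  where
  decreasing : ∀ c {ν} → Linked _>_ (raise c ν) → Linked _>_ ν
  decreasing c {[]}        _              = []
  decreasing c {_ ∷ []}    _              = [-]
  decreasing c {_ ∷ _ ∷ _} (s≤s v>w ∷ ds) = v>w ∷ decreasing c ds
  positive : ∀ ν → All (1 ≤_) (lower ν)
  positive []                = []
  positive (zero ∷ ν)        = positive ν
  positive (suc zero ∷ ν)    = positive ν
  positive (suc (suc _) ∷ ν) = s≤s z≤n ∷ positive ν
  bounded : ∀ {k ν} → All (_≤ suc k) ν → All (_≤ k) (lower ν)
  bounded {ν = []}              []             = []
  bounded {ν = zero ∷ _}        (_ ∷ bs)       = bounded bs
  bounded {ν = suc zero ∷ _}    (_ ∷ bs)       = bounded bs
  bounded {ν = suc (suc _) ∷ _} (s≤s v≤k ∷ bs) = v≤k ∷ bounded bs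

DistinctParts[0]⇒[] : ∀ {ν} → DistinctParts 0 ν → ν ≡ []
DistinctParts[0]⇒[] (distinctParts _ []          _)       = refl
DistinctParts[0]⇒[] (distinctParts _ (s≤s _ ∷ _) (() ∷ _))

addPart : ℕ → ℕ → List ℕ × List ℕ → List ℕ × List ℕ
addPart x y (π , ν) = x + length ν′ ∷ π , ν′
  where ν′ = raise (parity (x ∸ y) ⁻¹) ν

toSigned : List ℕ → List ℕ × List ℕ
toSigned []       = [] , []
toSigned (x ∷ xs) = addPart x (headOr 1 xs) (toSigned xs)

fromSigned : List ℕ → List ℕ → List ℕ
fromSigned []      _ = []
fromSigned (y ∷ π) ν = y ∸ length ν ∷ fromSigned π (lower ν)

-- The sentinel 1 appended to π makes "positive parts, the smallest one even" part of the
-- chain condition: π_k ≥ 1 and π_k has parity opposite to 1.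
Restricted : List ℕ × List ℕ → Set
Restricted (π , ν) = Linked OddDrop (π ∷ʳ 1) × DistinctParts (length π) ν

head-toSigned : ∀ xs → headOr 1 (proj₁ (toSigned xs)) ≡ headOr 1 xs + length (proj₂ (toSigned xs))
head-toSigned []      = refl
head-toSigned (_ ∷ _) = refl

sum-toSigned : ∀ xs → sum (proj₁ (toSigned xs)) ≡ sum xs + sum (proj₂ (toSigned xs))
sum-toSigned []       = refl
sum-toSigned (x ∷ xs) = begin
  x + L + sum π                ≡⟨ cong (x + L +_) (sum-toSigned xs) ⟩
  x + L + (sum xs + sum ν)     ≡⟨ interchange x L (sum xs) (sum ν) ⟩
  x + sum xs + (L + sum ν)     ≡⟨ cong (x + sum xs +_) (+-comm L (sum ν)) ⟩
  x + sum xs + (sum ν + L)     ≡⟨ cong (x + sum xs +_) (sum-raise c ν) ⟨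
  x + sum xs + sum (raise c ν) ∎
  where
  open ≡-Reasoning
  π = proj₁ (toSigned xs)
  ν = proj₂ (toSigned xs)
  c = parity (x ∸ headOr 1 xs) ⁻¹
  L = length (raise c ν)

toSigned-restricted : ∀ {xs} → Linked _≥_ (xs ∷ʳ 1) → Restricted (toSigned xs)
toSigned-restricted {[]}     _     = [-] , distinctParts [] [] []
toSigned-restricted {x ∷ xs} chain with Linked-∷-∷ʳ⁻ chain
... | x≥y , rest with toSigned-restricted rest
... | drops , parts = Linked-∷-∷ʳ⁺ drop drops , raise⁺ c parts
  where
  ν = proj₂ (toSigned xs)
  c = parity (x ∸ headOr 1 xs) ⁻¹
  drop : OddDrop (x + length (raise c ν)) (headOr 1 (proj₁ (toSigned xs)))
  drop rewrite head-toSigned xs | length-raise c ν = oddDrop-raise (length ν) x≥y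

fromSigned-toSigned : ∀ {xs} → Linked _≥_ (xs ∷ʳ 1) → uncurry fromSigned (toSigned xs) ≡ xs
fromSigned-toSigned {[]}     _     = refl
fromSigned-toSigned {x ∷ xs} chain = cong₂ _∷_ (m+n∸n≡m x (length (raise c ν))) (begin
  fromSigned π (lower (raise c ν)) ≡⟨ cong (fromSigned π) (lower-raise c ν-positive) ⟩
  fromSigned π ν                   ≡⟨ fromSigned-toSigned rest ⟩
  xs                               ∎)
  where
  open ≡-Reasoning
  rest = proj₂ (Linked-∷-∷ʳ⁻ chain)
  π = proj₁ (toSigned xs)
  ν = proj₂ (toSigned xs)
  c = parity (x ∸ headOr 1 xs) ⁻¹
  ν-positive : All (1 ≤_) ν
  ν-positive = DistinctParts.positive (proj₂ (toSigned-restricted rest))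

addPart-inverse : ∀ {y x′ ν} ys ν′ c → raise c ν′ ≡ ν → OddDrop y (x′ + length ν′) →
                  let x = y ∸ length ν in x ≥ x′ × addPart x x′ (ys , ν′) ≡ (y ∷ ys , ν)
addPart-inverse {y} {x′} ys ν′ c refl drop rewrite length-raise c ν′
  with oddDrop-lower x′ (length ν′) c drop
... | x≥x′ , gap , x+n≡y = x≥x′ , (begin
  (x + length (raise (parity (x ∸ x′) ⁻¹) ν′) ∷ ys , raise (parity (x ∸ x′) ⁻¹) ν′)
    ≡⟨ cong (λ c → x + length (raise c ν′) ∷ ys , raise c ν′) gap ⟩
  (x + length (raise c ν′) ∷ ys , raise c ν′)
    ≡⟨ cong (λ z → x + z ∷ ys , raise c ν′) (length-raise c ν′) ⟩
  (x + (length ν′ + toℕ c) ∷ ys , raise c ν′)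
    ≡⟨ cong (λ z → z ∷ ys , raise c ν′) x+n≡y ⟩
  (y ∷ ys , raise c ν′) ∎)
  where
  open ≡-Reasoning
  x = y ∸ (length ν′ + toℕ c)

toSigned-fromSigned : ∀ {π ν} → Restricted (π , ν) →
                      Linked _≥_ (fromSigned π ν ∷ʳ 1) × toSigned (fromSigned π ν) ≡ (π , ν)
toSigned-fromSigned {[]}     (_ , parts) rewrite DistinctParts[0]⇒[] parts = [-] , refl
toSigned-fromSigned {y ∷ ys} {ν} (drops , parts) with Linked-∷-∷ʳ⁻ drops
... | drop , rest with toSigned-fromSigned {ys} {lower ν} (rest , lower⁺ parts)
... | chain , eq =
  let x≥x′ , inverse = addPart-inverse ys (lower ν) (hasOne ν) (raise-lower decreasing positive)
                                       (subst (OddDrop y) head-eq drop)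
  in Linked-∷-∷ʳ⁺ x≥x′ chain , trans (cong (addPart (y ∸ length ν) x′) eq) inverse
  where
  open DistinctParts parts
  λ′ = fromSigned ys (lower ν)
  x′ = headOr 1 λ′
  head-eq : headOr 1 ys ≡ x′ + length (lower ν)
  head-eq = subst (λ (π , ν) → headOr 1 π ≡ x′ + length ν) eq (head-toSigned λ′)

sum-fromSigned : ∀ {π ν} → Restricted (π , ν) → sum π ≡ sum (fromSigned π ν) + sum ν
sum-fromSigned {π} {ν} r = subst (λ (π′ , ν′) → sum π′ ≡ sum (fromSigned π ν) + sum ν′)
                                 (proj₂ (toSigned-fromSigned r)) (sum-toSigned (fromSigned π ν))

Linked[∷ʳ1]⇔IsPartition : ∀ {xs} → Linked _≥_ (xs ∷ʳ 1) ⇔ IsPartition xs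
Linked[∷ʳ1]⇔IsPartition = Linked-∷ʳ⇔ (flip ≤-trans)

AltFromEven⇔Linked[1∷] : ∀ zs → AltFromEven zs ⇔ Linked OppParity (1 ∷ zs)
AltFromEven⇔Linked[1∷] []       = mk⇔ (λ _ → [-]) (λ _ → tt)
AltFromEven⇔Linked[1∷] (z ∷ zs) = mk⇔
  (λ (even , alt) → to (Even⇔OppParity[1] z) even ∷ alt)
  (λ { (opp ∷ alt) → from (Even⇔OppParity[1] z) opp , alt })

AltFromEven[reverse]⇔Linked[∷ʳ1] : ∀ π → AltFromEven (reverse π) ⇔ Linked OppParity (π ∷ʳ 1)
AltFromEven[reverse]⇔Linked[∷ʳ1] π = mk⇔
  (λ alt → Linked-reverse⁻ (λ {a b} → OppParity-sym {a} {b})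
             (subst (Linked OppParity) (sym rev) (to (AltFromEven⇔Linked[1∷] (reverse π)) alt)))
  (λ alt → from (AltFromEven⇔Linked[1∷] (reverse π))
             (subst (Linked OppParity) rev (Linked-reverse⁺ (λ {a b} → OppParity-sym {a} {b}) alt)))
  where
  rev : reverse (π ∷ʳ 1) ≡ 1 ∷ reverse π
  rev = reverse-++ π [ 1 ]

Linked[∷ʳ1]-OddDrop⇔ : ∀ {π} → Linked OddDrop (π ∷ʳ 1) ⇔ (IsPartition π × AltFromEven (reverse π))
Linked[∷ʳ1]-OddDrop⇔ {π} = mk⇔
  (λ drops → let chain , alt = Linked.unzip drops in
     to Linked[∷ʳ1]⇔IsPartition chain , from (AltFromEven[reverse]⇔Linked[∷ʳ1] π) alt)
  (λ (part , alt) →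
     Linked.zip (from Linked[∷ʳ1]⇔IsPartition part , to (AltFromEven[reverse]⇔Linked[∷ʳ1] π) alt))

Restricted⇒RestrictedSignedPartition : ∀ {n π ν} → Restricted (π , ν) → sum π ≡ n + sum ν →
                                        RestrictedSignedPartition n
Restricted⇒RestrictedSignedPartition {π = π} {ν} (drops , distinctParts dec pos bnd) s =
  let part , alt = to Linked[∷ʳ1]-OddDrop⇔ drops in
  (π , ν) , (part , (Linked.map <⇒≤ dec , pos) , s) , alt , dec , bnd

RestrictedSignedPartition⇒Restricted : ∀ {n} (p : RestrictedSignedPartition n) → Restricted (proj₁ p)
RestrictedSignedPartition⇒Restricted (_ , (part , (_ , pos) , _) , alt , dec , bnd) =
  from Linked[∷ʳ1]-OddDrop⇔ (part , alt) , distinctParts dec pos bnd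

IsPartition-irrelevant : ∀ {xs} → Irrelevant (IsPartition xs)
IsPartition-irrelevant = ×-irrelevant (Linked.irrelevant ≤-irrelevant) (All.irrelevant ≤-irrelevant)

AltFromEven-irrelevant : ∀ {zs} → Irrelevant (AltFromEven zs)
AltFromEven-irrelevant {[]}    _ _ = refl
AltFromEven-irrelevant {_ ∷ _} = ×-irrelevant ≡-irrelevant (Linked.irrelevant ≡-irrelevant)

Partition-≡ : ∀ {n} {p q : Partition n} → proj₁ p ≡ proj₁ q → p ≡ q
Partition-≡ = proj₁-injective (×-irrelevant IsPartition-irrelevant ≡-irrelevant)

RestrictedSignedPartition-≡ : ∀ {n} {p q : RestrictedSignedPartition n} → proj₁ p ≡ proj₁ q → p ≡ q
RestrictedSignedPartition-≡ = proj₁-injective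
  (×-irrelevant (×-irrelevant IsPartition-irrelevant (×-irrelevant IsPartition-irrelevant ≡-irrelevant))
    (×-irrelevant AltFromEven-irrelevant
      (×-irrelevant (Linked.irrelevant ≤-irrelevant) (All.irrelevant ≤-irrelevant))))

Partition↔RestrictedSignedPartition : ∀ n → Partition n ↔ RestrictedSignedPartition n
Partition↔RestrictedSignedPartition n = mk↔ₛ′ forward backward forward∘backward backward∘forward
  where
  forward : Partition n → RestrictedSignedPartition n
  forward (xs , part , s) =
    Restricted⇒RestrictedSignedPartition (toSigned-restricted (from Linked[∷ʳ1]⇔IsPartition part))
                                         (trans (sum-toSigned xs) (cong (_+ _) s))
  backward : RestrictedSignedPartition n → Partition n
  backward p@((π , ν) , (_ , _ , s) , _) =
    fromSigned π ν , to Linked[∷ʳ1]⇔IsPartition (proj₁ (toSigned-fromSigned r)) ,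
    +-cancelʳ-≡ (sum ν) _ n (trans (sym (sum-fromSigned r)) s)
    where r = RestrictedSignedPartition⇒Restricted p
  forward∘backward : ∀ p → forward (backward p) ≡ p
  forward∘backward p =
    RestrictedSignedPartition-≡ (proj₂ (toSigned-fromSigned (RestrictedSignedPartition⇒Restricted p)))
  backward∘forward : ∀ p → backward (forward p) ≡ p
  backward∘forward (_ , part , _) = Partition-≡ (fromSigned-toSigned (from Linked[∷ʳ1]⇔IsPartition part))

BoundedPartition : ℕ → ℕ → Set
BoundedPartition b n = Σ (List ℕ) λ xs → (Linked _≥_ (b ∷ xs) × All (1 ≤_) xs) × sum xs ≡ n

BoundedPartition-≡ : ∀ {b n} {p q : BoundedPartition b n} → proj₁ p ≡ proj₁ q → p ≡ q
BoundedPartition-≡ = proj₁-injective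
  (×-irrelevant (×-irrelevant (Linked.irrelevant ≤-irrelevant) (All.irrelevant ≤-irrelevant)) ≡-irrelevant)

Partition↔BoundedPartition : ∀ {b n} → n ≤ b → Partition n ↔ BoundedPartition b n
Partition↔BoundedPartition {b} {n} n≤b =
  mk↔ₛ′ bound unbound (λ _ → BoundedPartition-≡ refl) (λ _ → Partition-≡ refl)
  where
  bounded : ∀ {xs} → Linked _≥_ xs → sum xs ≤ b → Linked _≥_ (b ∷ xs)
  bounded {[]}     _ _   = [-]
  bounded {x ∷ xs} l ≤b  = ≤-trans (m≤m+n x (sum xs)) ≤b ∷ l
  bound : Partition n → BoundedPartition b n
  bound (xs , (l , pos) , s) = xs , (bounded l (subst (_≤ b) (sym s) n≤b) , pos) , s
  unbound : BoundedPartition b n → Partition n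
  unbound (xs , (l , pos) , s) = xs , (Linked.tail l , pos) , s

BoundedPartition[0]-empty : ∀ {n} (p : BoundedPartition 0 n) → proj₁ p ≡ []
BoundedPartition[0]-empty ([] , _)                           = refl
BoundedPartition[0]-empty (_ ∷ _ , ((z≤n ∷ _) , (() ∷ _)) , _)

BoundedPartition[0,0]↔Fin1 : BoundedPartition 0 0 ↔ Fin 1
BoundedPartition[0,0]↔Fin1 = mk↔ₛ′ (λ _ → Fin.zero) (λ _ → [] , ([-] , []) , refl)
  (λ { Fin.zero → refl ; (Fin.suc ()) }) (λ p → BoundedPartition-≡ (sym (BoundedPartition[0]-empty p)))

BoundedPartition[0,1+n]↔Fin0 : ∀ {n} → BoundedPartition 0 (suc n) ↔ Fin 0
BoundedPartition[0,1+n]↔Fin0 = mk↔ₛ′ (λ p → ⊥-elim (empty p)) (λ ()) (λ ()) (λ p → ⊥-elim (empty p))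
  where
  empty : ∀ {n} → BoundedPartition 0 (suc n) → ⊥
  empty p with BoundedPartition[0]-empty p
  empty (_ , _ , ()) | refl

BoundedPartition-split : ∀ b k →
  BoundedPartition (suc b) (suc b + k) ↔ (BoundedPartition b (suc b + k) ⊎ BoundedPartition (suc b) k)
BoundedPartition-split b k = mk↔ₛ′ split merge split∘merge merge∘split
  where
  split : BoundedPartition (suc b) (suc b + k) → BoundedPartition b (suc b + k) ⊎ BoundedPartition (suc b) k
  split (x ∷ xs , (x≤1+b ∷ l , pos) , s) with x ≟ suc b
  ... | yes refl   = inj₂ (xs , (l , All.tail pos) , +-cancelˡ-≡ (suc b) _ _ s)
  ... | no x≢1+b   = inj₁ (x ∷ xs , (≤-pred (≤∧≢⇒< x≤1+b x≢1+b) ∷ l , pos) , s)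
  merge : BoundedPartition b (suc b + k) ⊎ BoundedPartition (suc b) k → BoundedPartition (suc b) (suc b + k)
  merge (inj₁ (xs , (l , pos) , s)) = xs , (weaken l , pos) , s
    where
    weaken : ∀ {xs} → Linked _≥_ (b ∷ xs) → Linked _≥_ (suc b ∷ xs)
    weaken [-]       = [-]
    weaken (x≤b ∷ l) = m≤n⇒m≤1+n x≤b ∷ l
  merge (inj₂ (xs , (l , pos) , s)) = suc b ∷ xs , (≤-refl ∷ l , s≤s z≤n ∷ pos) , cong (suc b +_) s
  split∘merge : ∀ p → split (merge p) ≡ p
  split∘merge (inj₁ (x ∷ _ , (x≤b ∷ _ , _) , _)) with x ≟ suc b
  ... | yes refl = ⊥-elim (1+n≰n x≤b)
  ... | no _     = cong inj₁ (BoundedPartition-≡ refl)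
  split∘merge (inj₂ _) with suc b ≟ suc b
  ... | yes refl       = cong inj₂ (BoundedPartition-≡ refl)
  ... | no 1+b≢1+b     = ⊥-elim (1+b≢1+b refl)
  merge∘split : ∀ p → merge (split p) ≡ p
  merge∘split (x ∷ _ , (_ ∷ _ , _) , _) with x ≟ suc b
  ... | yes refl = BoundedPartition-≡ refl
  ... | no _     = BoundedPartition-≡ refl

BoundedPartition-finite : ∀ n b → Σ ℕ λ m → BoundedPartition b n ↔ Fin m
BoundedPartition-finite = <-rec (λ n → ∀ b → Σ ℕ λ m → BoundedPartition b n ↔ Fin m) count
  where
  count : ∀ n → (∀ {n′} → n′ < n → ∀ b → Σ ℕ λ m → BoundedPartition b n′ ↔ Fin m) →
          ∀ b → Σ ℕ λ m → BoundedPartition b n ↔ Fin m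
  count zero    _   zero    = 1 , BoundedPartition[0,0]↔Fin1
  count (suc n) _   zero    = 0 , BoundedPartition[0,1+n]↔Fin0
  count n       rec (suc b) with suc b ≤? n
  ... | no 1+b≰n =
    let m , iso = count n rec b
        n<1+b = ≰⇒> 1+b≰n
    in m , ↔-trans (↔-sym (Partition↔BoundedPartition (<⇒≤ n<1+b)))
                   (↔-trans (Partition↔BoundedPartition (≤-pred n<1+b)) iso)
  ... | yes 1+b≤n with m≤n⇒∃[o]m+o≡n 1+b≤n
  ... | k , refl =
    let m₁ , iso₁ = count (suc b + k) rec b
        m₂ , iso₂ = rec (s≤s (m≤n+m k b)) (suc b)
    in m₁ + m₂ , ↔-trans (BoundedPartition-split b k) (↔-trans (iso₁ ⊎-↔ iso₂) (↔-sym +↔⊎))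

Partition-finite : ∀ n → Σ ℕ λ m → Partition n ↔ Fin m
Partition-finite n =
  let m , iso = BoundedPartition-finite n n in m , ↔-trans (Partition↔BoundedPartition ≤-refl) iso

theorem2p2 : (n : ℕ) → Σ ℕ λ m → HasCard (Partition n) m × HasCard (RestrictedSignedPartition n) m
theorem2p2 n =
  let m , card = Partition-finite n
  in m , card , ↔-trans (↔-sym (Partition↔RestrictedSignedPartition n)) card
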